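{- Let $\pi\in S_n(1423)$ with $\pi\neq n(n-1)\ldots 1$, let $\phi(\pi)=(a,b)$, and let $m=a+\rho(\pi)+1$ and $l=n-a-\rho(\pi)$. Then $$\operatorname{Des}\pi^{(1)}=\{i\in\operatorname{Des}\pi: 1\le i\le a\}\cup[a+1,m-1]$$ and $$\operatorname{Des}\pi^{(2)}=\{i-a: i\in\operatorname{Des}\pi,\ a<i<b\}\cup[b-a,l-1].$$
   Context: $[x,y]=\{x,\dots,y\}$ (empty if $x>y$). $\mathrm{std}$ of a sequence of distinct integers is the permutation order-isomorphic to it. $S_n(1423)$ is the set of permutations in $S_n$ with no subsequence order-isomorphic to $1423$. $\operatorname{Des}\pi=\{i:\pi_i>\pi_{i+1}\}$. $\operatorname{RLmax}\pi$ is the set of indices $i$ with $\pi_i>\pi_j$ for all $j>i$. For $\pi\ne n(n-1)\ldots1$, $\phi(\pi)=(a,b)$: $b$ is the smallest index with $[b,n]\subseteq\operatorname{RLmax}\pi$; $a=0$ if $\operatorname{RLmax}\pi=[b,n]$, otherwise $a=\max(\operatorname{RLmax}\pi\setminus[b,n])$. $\chi(\pi)=\max\{\pi_i:a<i<b\}$, $\rho(\pi)=|\{i\in\operatorname{RLmax}\pi:i>b,\ \pi_i>\chi(\pi)\}|$, $\pi^{(1)}=\mathrm{std}(\pi_1\ldots\pi_a\pi_b\pi_{b+1}\ldots\pi_{b+\rho(\pi)})$, $\pi^{(2)}=\mathrm{std}(\pi_{a+1}\ldots\pi_b\pi_{b+\rho(\pi)+1}\ldots\pi_n)$. -}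

module Defs where

open import Data.Nat using (ℕ; zero; suc; _+_; _∸_; _≤_; _<_; _⊔_; _<ᵇ_)
open import Data.Bool using (Bool; true; false; not; _∧_)
open import Data.List using (List; []; _∷_; _++_; map; filter; foldr; length; take; drop; applyUpTo; reverse)
open import Data.List.Relation.Binary.Permutation.Propositional using (_↭_)
open import Data.Product using (∃; _×_)
open import Relation.Nullary using (¬_)
open import Relation.Binary.PropositionalEquality using (_≡_)
open import Relation.Nullary.Decidable using (does)
import Data.Nat as ℕ

range1 : ℕ → List ℕ
range1 n = applyUpTo suc n

interval : ℕ → ℕ → List ℕ
interval x y = applyUpTo (λ k → x + k) (suc y ∸ x)

-- S_n: a permutation of [n] in one-line notation π₁ … πₙ (as a list)
IsPerm : ℕ → List ℕ → Set
IsPerm n π = π ↭ range1 n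

decreasing : ℕ → List ℕ
decreasing n = reverse (range1 n)

-- 1-based entry π_i (0 if out of range; only used in range)
get : List ℕ → ℕ → ℕ
get [] _ = 0
get (x ∷ xs) zero = 0
get (x ∷ xs) (suc zero) = x
get (x ∷ xs) (suc (suc k)) = get xs (suc k)

Contains1423 : List ℕ → Set
Contains1423 π = ∃ λ i → ∃ λ j → ∃ λ k → ∃ λ l →
  1 ≤ i × i < j × j < k × k < l × l ≤ length π ×
  get π i < get π k × get π k < get π l × get π l < get π j

Avoids1423 : List ℕ → Set
Avoids1423 π = ¬ Contains1423 π

Des : List ℕ → ℕ → Set
Des π i = 1 ≤ i × suc i ≤ length π × get π (suc i) < get π i

countLess : ℕ → List ℕ → ℕ
countLess x xs = length (filter (λ y → y ℕ.<? x) xs)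

std : List ℕ → List ℕ
std xs = map (λ x → suc (countLess x xs)) xs

allB : (ℕ → Bool) → List ℕ → Bool
allB p = foldr (λ x r → p x ∧ r) true

isRLmax : List ℕ → ℕ → Bool
isRLmax π i = allB (λ j → get π j <ᵇ get π i) (interval (suc i) (length π))

maxList : List ℕ → ℕ
maxList = foldr _⊔_ 0

-- φ(π) = (a , b)
-- b = smallest index with [b,n] ⊆ RLmax π
--   = 1 + (largest index in [1,n] not in RLmax π), or 1 if there is none
φb : List ℕ → ℕ
φb π = suc (maxList (filter (λ i → not (isRLmax π i) Data.Bool.≟ true) (range1 (length π))))

-- a = max (RLmax π ∖ [b,n]), or 0 if RLmax π = [b,n]
φa : List ℕ → ℕ
φa π = maxList (filter (λ i → (isRLmax π i ∧ (i <ᵇ φb π)) Data.Bool.≟ true) (range1 (length π)))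

χ : List ℕ → ℕ
χ π = maxList (map (get π) (interval (suc (φa π)) (φb π ∸ 1)))

ρ : List ℕ → ℕ
ρ π = length (filter (λ i → (isRLmax π i ∧ (χ π <ᵇ get π i)) Data.Bool.≟ true)
                     (interval (suc (φb π)) (length π)))

-- π⁽¹⁾ = std(π_1 … π_a π_b π_{b+1} … π_{b+ρ})
π⁽¹⁾ : List ℕ → List ℕ
π⁽¹⁾ π = std (take (φa π) π ++ take (suc (ρ π)) (drop (φb π ∸ 1) π))

-- π⁽²⁾ = std(π_{a+1} … π_b π_{b+ρ+1} … π_n)
π⁽²⁾ : List ℕ → List ℕ
π⁽²⁾ π = std (take (φb π ∸ φa π) (drop (φa π) π) ++ drop (φb π + ρ π) π)

-- Standardisation preserves descents, so it suffices to compute the descents of the two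
-- concatenations that are standardised.  Every position from b on is a right-to-left maximum
-- of π, so π_b π_{b+1} … π_n is decreasing, and (for a ≥ 1) the right-to-left maximum π_a
-- exceeds all of it.  Hence π_1 … π_a π_b … π_{b+ρ} has the descents of π in [1, a] followed
-- by a descent at every later position, and π_{a+1} … π_b π_{b+ρ+1} … π_n has the descents of
-- π strictly between a and b, shifted by a, followed by a descent at every position from π_b on.
module Submission where

open import Defs
open import Data.Nat using (ℕ; zero; suc; _+_; _∸_; _≤_; _<_; z≤n; s≤s; s≤s⁻¹; _<ᵇ_; _<?_)
open import Data.Nat.Properties
open import Data.Bool using (Bool; true; false; not; _∧_; T)
open import Data.Bool.Properties using (T-≡; T-∧)
open import Data.List using (List; []; _∷_; _++_; map; filter; length; take; drop)
open import Data.List.Properties using (length-applyUpTo; length-take; length-drop; length-filter; filter-accept; filter-reject)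
open import Data.List.Membership.Propositional using (_∈_)
open import Data.List.Membership.Propositional.Properties using (∈-filter⁺; ∈-filter⁻; ∈-applyUpTo⁺; ∈-applyUpTo⁻)
open import Data.List.Relation.Unary.Any using (here; there)
open import Data.List.Relation.Binary.Permutation.Propositional.Properties using (↭-length)
open import Data.Product using (∃; _×_; _,_; proj₁; proj₂)
open import Data.Sum using (_⊎_; inj₁; inj₂)
open import Data.Empty using (⊥-elim)
open import Relation.Nullary using (¬_; yes; no)
open import Relation.Unary using (Decidable)
open import Relation.Binary.PropositionalEquality using (_≡_; _≢_; refl; sym; trans; cong; subst; subst₂)
open import Function.Base using (_∘_)
open import Function.Bundles using (_⇔_; mk⇔; Equivalence)
import Function.Properties.Equivalence as ⇔
open import Data.Nat.Tactic.RingSolver using (solve)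

get-take : ∀ k (xs : List ℕ) {i} → i ≤ k → get (take k xs) i ≡ get xs i
get-take zero    []       _ = refl
get-take (suc k) []       _ = refl
get-take zero    (x ∷ xs) {zero} _ = refl
get-take (suc k) (x ∷ xs) {zero} _ = refl
get-take (suc k) (x ∷ xs) {suc zero} _ = refl
get-take (suc k) (x ∷ xs) {suc (suc i)} (s≤s le) = get-take k xs le

get-drop : ∀ k (xs : List ℕ) j → get (drop k xs) (suc j) ≡ get xs (suc (k + j))
get-drop zero    xs       j = refl
get-drop (suc k) []       j = refl
get-drop (suc k) (x ∷ xs) j = get-drop k xs j

Des-zero : ∀ xs → ¬ Des xs 0
Des-zero xs (() , _)

Des-∷ : ∀ x xs i → Des (x ∷ xs) (suc (suc i)) ⇔ Des xs (suc i)
Des-∷ x xs i = mk⇔ (λ { (_ , s≤s le , lt) → s≤s z≤n , le , lt })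
                   (λ { (_ , le , lt) → s≤s z≤n , s≤s le , lt })

Des-++ˡ : ∀ (xs ys : List ℕ) {i} → suc i ≤ length xs → Des (xs ++ ys) i ⇔ Des xs i
Des-++ˡ xs             ys {zero}        _ = mk⇔ (⊥-elim ∘ Des-zero (xs ++ ys)) (⊥-elim ∘ Des-zero xs)
Des-++ˡ (x ∷ x′ ∷ xs)  ys {suc zero}    _ = mk⇔ (λ { (h , _ , lt) → h , s≤s (s≤s z≤n) , lt })
                                                 (λ { (h , _ , lt) → h , s≤s (s≤s z≤n) , lt })
Des-++ˡ (x ∷ xs)       ys {suc (suc i)} (s≤s le) =
  ⇔.trans (Des-∷ x (xs ++ ys) i) (⇔.trans (Des-++ˡ xs ys le) (⇔.sym (Des-∷ x xs i)))

Des-++ʳ : ∀ (xs ys : List ℕ) j → Des (xs ++ ys) (suc (length xs + j)) ⇔ Des ys (suc j)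
Des-++ʳ []       ys j = ⇔.refl
Des-++ʳ (x ∷ xs) ys j = ⇔.trans (Des-∷ x (xs ++ ys) (length xs + j)) (Des-++ʳ xs ys j)

Des-++-join : ∀ (xs ys : List ℕ) → 1 ≤ length xs →
  Des (xs ++ ys) (length xs) ⇔ (1 ≤ length ys × get ys 1 < get xs (length xs))
Des-++-join (x ∷ [])      ys _ = mk⇔ (λ { (_ , s≤s le , lt) → le , lt }) (λ { (le , lt) → s≤s z≤n , s≤s le , lt })
Des-++-join (x ∷ x′ ∷ xs) ys _ = ⇔.trans (Des-∷ x ((x′ ∷ xs) ++ ys) (length xs)) (Des-++-join (x′ ∷ xs) ys (s≤s z≤n))

Des-take : ∀ k (xs : List ℕ) i → Des (take k xs) i ⇔ (Des xs i × suc i ≤ k)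
Des-take k       xs            zero          = mk⇔ (⊥-elim ∘ Des-zero (take k xs)) (⊥-elim ∘ Des-zero xs ∘ proj₁)
Des-take zero    xs            (suc i)       = mk⇔ (λ { (_ , () , _) }) (λ { (_ , ()) })
Des-take (suc k) []            (suc i)       = mk⇔ (λ { (_ , () , _) }) (λ { ((_ , () , _) , _) })
Des-take (suc zero) (x ∷ xs)   (suc zero)    = mk⇔ (λ { (_ , s≤s () , _) }) (λ { (_ , s≤s ()) })
Des-take (suc (suc k)) (x ∷ []) (suc zero)   = mk⇔ (λ { (_ , s≤s () , _) }) (λ { ((_ , s≤s () , _) , _) })
Des-take (suc (suc k)) (x ∷ x′ ∷ xs) (suc zero) =
  mk⇔ (λ { (h , _ , lt) → (h , s≤s (s≤s z≤n) , lt) , s≤s (s≤s z≤n) })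
      (λ { ((h , _ , lt) , _) → h , s≤s (s≤s z≤n) , lt })
Des-take (suc k) (x ∷ xs)      (suc (suc i)) =
  ⇔.trans (Des-∷ x (take k xs) i)
    (⇔.trans (Des-take k xs (suc i))
      (mk⇔ (λ { (d , le) → Equivalence.from (Des-∷ x xs i) d , s≤s le })
           (λ { (d , s≤s le) → Equivalence.to (Des-∷ x xs i) d , le })))

Des-drop : ∀ k (xs : List ℕ) j → Des (drop k xs) (suc j) ⇔ Des xs (suc (k + j))
Des-drop zero    xs       j = ⇔.refl
Des-drop (suc k) []       j = mk⇔ (λ { (_ , () , _) }) (λ { (_ , () , _) })
Des-drop (suc k) (x ∷ xs) j = ⇔.trans (Des-drop k xs j) (⇔.sym (Des-∷ x xs (k + j)))

Des-map : ∀ (f : ℕ → ℕ) xs → (∀ {x y} → y ∈ xs → (f y < f x ⇔ y < x)) →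
  ∀ i → Des (map f xs) i ⇔ Des xs i
Des-map f xs            mono zero          = mk⇔ (⊥-elim ∘ Des-zero (map f xs)) (⊥-elim ∘ Des-zero xs)
Des-map f []            mono (suc i)       = mk⇔ (λ { (_ , () , _) }) (λ { (_ , () , _) })
Des-map f (x ∷ [])      mono (suc i)       = mk⇔ (λ { (_ , s≤s () , _) }) (λ { (_ , s≤s () , _) })
Des-map f (x ∷ x′ ∷ xs) mono (suc zero)    =
  mk⇔ (λ { (h , _ , lt) → h , s≤s (s≤s z≤n) , Equivalence.to (mono (there (here refl))) lt })
      (λ { (h , _ , lt) → h , s≤s (s≤s z≤n) , Equivalence.from (mono (there (here refl))) lt })
Des-map f (x ∷ xs)      mono (suc (suc i)) =
  ⇔.trans (Des-∷ (f x) (map f xs) i) (⇔.trans (Des-map f xs (mono ∘ there) (suc i)) (⇔.sym (Des-∷ x xs i)))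

countLess-∷-< : ∀ {x z} zs → z < x → countLess x (z ∷ zs) ≡ suc (countLess x zs)
countLess-∷-< {x} zs z<x = cong length (filter-accept (_<? x) z<x)

countLess-∷-≮ : ∀ {x z} zs → ¬ z < x → countLess x (z ∷ zs) ≡ countLess x zs
countLess-∷-≮ {x} zs z≮x = cong length (filter-reject (_<? x) z≮x)

countLess-mono-≤ : ∀ {x y} zs → y ≤ x → countLess y zs ≤ countLess x zs
countLess-mono-≤ []                 _   = z≤n
countLess-mono-≤ {x} {y} (z ∷ zs) y≤x with z <? y | z <? x
... | yes z<y | yes z<x rewrite countLess-∷-< zs z<y | countLess-∷-< zs z<x = s≤s (countLess-mono-≤ zs y≤x)
... | yes z<y | no  z≮x = ⊥-elim (z≮x (<-≤-trans z<y y≤x))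
... | no  z≮y | yes z<x rewrite countLess-∷-≮ zs z≮y | countLess-∷-< zs z<x = m≤n⇒m≤1+n (countLess-mono-≤ zs y≤x)
... | no  z≮y | no  z≮x rewrite countLess-∷-≮ zs z≮y | countLess-∷-≮ zs z≮x = countLess-mono-≤ zs y≤x

countLess-mono-< : ∀ {x y} zs → y ∈ zs → y < x → countLess y zs < countLess x zs
countLess-mono-< {x} (z ∷ zs) (here refl) z<x = begin-strict
  countLess z (z ∷ zs)  ≡⟨ countLess-∷-≮ zs (<-irrefl refl) ⟩
  countLess z zs        ≤⟨ countLess-mono-≤ zs (<⇒≤ z<x) ⟩
  countLess x zs        <⟨ n<1+n _ ⟩
  suc (countLess x zs)  ≡⟨ countLess-∷-< zs z<x ⟨
  countLess x (z ∷ zs)  ∎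
  where open ≤-Reasoning
countLess-mono-< {x} {y} (z ∷ zs) (there y∈zs) y<x with z <? y | z <? x
... | yes z<y | yes z<x rewrite countLess-∷-< zs z<y | countLess-∷-< zs z<x = s≤s (countLess-mono-< zs y∈zs y<x)
... | yes z<y | no  z≮x = ⊥-elim (z≮x (<-trans z<y y<x))
... | no  z≮y | yes z<x rewrite countLess-∷-≮ zs z≮y | countLess-∷-< zs z<x = m≤n⇒m≤1+n (countLess-mono-< zs y∈zs y<x)
... | no  z≮y | no  z≮x rewrite countLess-∷-≮ zs z≮y | countLess-∷-≮ zs z≮x = countLess-mono-< zs y∈zs y<x

Des-std : ∀ xs i → Des (std xs) i ⇔ Des xs i
Des-std xs = Des-map (λ x → suc (countLess x xs)) xs rank-<
  where
  rank-< : ∀ {x y} → y ∈ xs → (suc (countLess y xs) < suc (countLess x xs) ⇔ y < x)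
  rank-< {x} {y} y∈xs = mk⇔ (λ lt → ≰⇒> (<⇒≱ (s≤s⁻¹ lt) ∘ countLess-mono-≤ xs)) (s≤s ∘ countLess-mono-< xs y∈xs)

nonempty-take : ∀ k (zs : List ℕ) → 1 ≤ length zs → 1 ≤ length (take (suc k) zs)
nonempty-take k (z ∷ zs) _ = s≤s z≤n

data Position (a : ℕ) : ℕ → Set where
  before : ∀ {i} → i < a → Position a i
  at     : Position a a
  after  : ∀ j → Position a (suc (a + j))

position : ∀ a i → Position a i
position zero    zero    = at
position zero    (suc j) = after j
position (suc a) zero    = before (s≤s z≤n)
position (suc a) (suc i) with position a i
... | before i<a = before (s≤s i<a)
... | at         = at
... | after j    = after j

≤∸⇔+≤ : ∀ {m n o} → 1 ≤ m → (m ≤ o ∸ n ⇔ m + n ≤ o)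
≤∸⇔+≤ {m} {n} {o} 1≤m = mk⇔ (λ le → m≤o∸n⇒m+n≤o m (n≤o le) le) (m+n≤o⇒m≤o∸n m)
  where
  n≤o : m ≤ o ∸ n → n ≤ o
  n≤o le = <⇒≤ (m∸n≢0⇒n<m (λ eq → <-irrefl (sym eq) (≤-trans 1≤m le)))

RLmax : List ℕ → ℕ → Set
RLmax π i = ∀ k → i < k → k ≤ length π → get π k < get π i

RLmax⇒Des : ∀ π {i} → RLmax π i → 1 ≤ i → suc i ≤ length π → Des π i
RLmax⇒Des π rl 1≤i i<L = 1≤i , i<L , rl _ ≤-refl i<L

module PrefixAndBlock (π : List ℕ) {a b′ ρ : ℕ} (a≤b′ : a ≤ b′) (b+ρ≤L : suc b′ + ρ ≤ length π)
  (rl-a : 1 ≤ a → RLmax π a) (rl-tail : ∀ {j} → suc b′ ≤ j → j ≤ length π → RLmax π j) where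

  xs ys : List ℕ
  xs = take a π
  ys = take (suc ρ) (drop b′ π)

  RHS : ℕ → Set
  RHS i = (Des π i × 1 ≤ i × i ≤ a) ⊎ (a + 1 ≤ i × i ≤ (a + ρ + 1) ∸ 1)

  b≤L : suc b′ ≤ length π
  b≤L = m+n≤o⇒m≤o (suc b′) b+ρ≤L

  |xs| : length xs ≡ a
  |xs| = trans (length-take a π) (m≤n⇒m⊓n≡m (≤-trans a≤b′ (<⇒≤ b≤L)))

  Des-before : ∀ {i} → i < a → Des (xs ++ ys) i ⇔ RHS i
  Des-before {i} i<a =
    ⇔.trans (Des-++ˡ xs ys (subst (suc i ≤_) (sym |xs|) i<a)) (⇔.trans (Des-take a π i) (mk⇔ to from))
    where
    to : Des π i × suc i ≤ a → RHS i
    to (d , _) = inj₁ (d , proj₁ d , <⇒≤ i<a)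
    from : RHS i → Des π i × suc i ≤ a
    from (inj₁ (d , _))     = d , i<a
    from (inj₂ (a+1≤i , _)) = ⊥-elim (<⇒≱ i<a (≤-trans (m≤m+n a 1) a+1≤i))

  -- Both sides hold as soon as a ≥ 1, and both force a ≥ 1.
  Des-at : Des (xs ++ ys) a ⇔ RHS a
  Des-at = mk⇔ (λ d → proj₂ (both (proj₁ d))) (λ r → proj₁ (both (RHS⇒1≤a r)))
    where
    RHS⇒1≤a : RHS a → 1 ≤ a
    RHS⇒1≤a (inj₁ (_ , 1≤a , _)) = 1≤a
    RHS⇒1≤a (inj₂ (a+1≤a , _))   = ⊥-elim (m+1+n≰m a a+1≤a)
    get-ys-1 : get ys 1 ≡ get π (suc b′)
    get-ys-1 = trans (get-take (suc ρ) (drop b′ π) (s≤s z≤n))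
                 (trans (get-drop b′ π 0) (cong (λ m → get π (suc m)) (+-identityʳ b′)))
    1≤|ys| : 1 ≤ length ys
    1≤|ys| = nonempty-take ρ (drop b′ π) (subst (1 ≤_) (sym (length-drop b′ π)) (m<n⇒0<n∸m b≤L))
    both : 1 ≤ a → Des (xs ++ ys) a × RHS a
    both 1≤a = Equivalence.from join (1≤|ys| , π-b<π-a) , inj₁ (Des-π-a , 1≤a , ≤-refl)
      where
      join : Des (xs ++ ys) a ⇔ (1 ≤ length ys × get ys 1 < get xs a)
      join = subst (λ m → Des (xs ++ ys) m ⇔ (1 ≤ length ys × get ys 1 < get xs m)) |xs|
                   (Des-++-join xs ys (subst (1 ≤_) (sym |xs|) 1≤a))
      π-b<π-a : get ys 1 < get xs a
      π-b<π-a = subst₂ _<_ (sym get-ys-1) (sym (get-take a π ≤-refl)) (rl-a 1≤a (suc b′) (s≤s a≤b′) b≤L)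
      Des-π-a : Des π a
      Des-π-a = RLmax⇒Des π (rl-a 1≤a) 1≤a (≤-trans (s≤s a≤b′) b≤L)

  Des-after : ∀ j → Des (xs ++ ys) (suc (a + j)) ⇔ RHS (suc (a + j))
  Des-after j = ⇔.trans (subst (λ m → Des (xs ++ ys) (suc (m + j)) ⇔ Des ys (suc j)) |xs| (Des-++ʳ xs ys j))
                  (⇔.trans (Des-take (suc ρ) (drop b′ π) (suc j)) (mk⇔ to from))
    where
    upper : suc (a + j) ≤ a + ρ + 1 ∸ 1 ⇔ j < ρ
    upper = subst (λ m → suc (a + j) ≤ m ⇔ j < ρ) (sym (m+n∸n≡m (a + ρ) 1))
              (mk⇔ (+-cancelˡ-< a j ρ) (+-monoʳ-< a))
    to : Des (drop b′ π) (suc j) × suc (suc j) ≤ suc ρ → RHS (suc (a + j))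
    to (_ , s≤s j<ρ) = inj₂ (subst (_≤ suc (a + j)) (+-comm 1 a) (s≤s (m≤m+n a j)) , Equivalence.from upper j<ρ)
    from : RHS (suc (a + j)) → Des (drop b′ π) (suc j) × suc (suc j) ≤ suc ρ
    from (inj₁ (_ , _ , a+j<a)) = ⊥-elim (m+n≮m a j a+j<a)
    from (inj₂ (_ , le)) = Equivalence.from (Des-drop b′ π j) Des-π , s≤s j<ρ
      where
      j<ρ = Equivalence.to upper le
      k<L : suc (suc (b′ + j)) ≤ length π
      k<L = ≤-trans (s≤s (+-monoʳ-< b′ j<ρ)) b+ρ≤L
      Des-π = RLmax⇒Des π (rl-tail (s≤s (m≤m+n b′ j)) (<⇒≤ k<L)) (s≤s z≤n) k<L

  descents : ∀ i → Des (xs ++ ys) i ⇔ RHS i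
  descents i with position a i
  ... | before i<a = Des-before i<a
  ... | at         = Des-at
  ... | after j    = Des-after j

Des-take++take-drop : ∀ π {a b ρ} → a < b → b + ρ ≤ length π →
  (1 ≤ a → RLmax π a) → (∀ {j} → b ≤ j → j ≤ length π → RLmax π j) →
  ∀ i → Des (take a π ++ take (suc ρ) (drop (b ∸ 1) π)) i ⇔
        ((Des π i × 1 ≤ i × i ≤ a) ⊎ (a + 1 ≤ i × i ≤ (a + ρ + 1) ∸ 1))
Des-take++take-drop π {b = suc b′} (s≤s a≤b′) = PrefixAndBlock.descents π a≤b′

module SegmentAndSuffix (π : List ℕ) {a d′ ρ : ℕ} (b+ρ≤L : a + suc d′ + ρ ≤ length π)
  (rl-tail : ∀ {j} → a + suc d′ ≤ j → j ≤ length π → RLmax π j) where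

  d b : ℕ
  d = suc d′
  b = a + d

  xs ys : List ℕ
  xs = take d (drop a π)
  ys = drop (b + ρ) π

  RHS : ℕ → Set
  RHS i = (∃ λ j → Des π j × a < j × j < b × i ≡ j ∸ a) ⊎ (d ≤ i × i ≤ (length π ∸ a ∸ ρ) ∸ 1)

  |xs| : length xs ≡ d
  |xs| = trans (length-take d (drop a π)) (m≤n⇒m⊓n≡m (subst (d ≤_) (sym (length-drop a π)) d≤L∸a))
    where
    d≤L∸a = m+n≤o⇒m≤o∸n d (subst (_≤ length π) (+-comm a d) (m+n≤o⇒m≤o b b+ρ≤L))

  RHS-tail : ∀ {k} → d ≤ k → RHS k ⇔ k + 1 + ρ + a ≤ length π
  RHS-tail {k} d≤k = mk⇔ to (λ room → inj₂ (d≤k , Equivalence.from bound room))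
    where
    1≤k = ≤-trans (s≤s z≤n) d≤k
    bound : k ≤ length π ∸ a ∸ ρ ∸ 1 ⇔ k + 1 + ρ + a ≤ length π
    bound = ⇔.trans (≤∸⇔+≤ 1≤k) (⇔.trans (≤∸⇔+≤ (≤-trans 1≤k (m≤m+n _ 1)))
              (≤∸⇔+≤ (≤-trans 1≤k (≤-trans (m≤m+n _ 1) (m≤m+n _ ρ)))))
    to : RHS k → k + 1 + ρ + a ≤ length π
    to (inj₁ (j , _ , a<j , j<b , k≡j∸a)) =
      ⊥-elim (<⇒≱ (subst (j ∸ a <_) (m+n∸m≡n a d) (∸-monoˡ-< j<b (<⇒≤ a<j))) (subst (d ≤_) k≡j∸a d≤k))
    to (inj₂ (_ , le)) = Equivalence.to bound le

  Des-before : ∀ {i} → i < d → Des (xs ++ ys) i ⇔ RHS i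
  Des-before {zero} _ = mk⇔ (⊥-elim ∘ Des-zero (xs ++ ys)) λ
    { (inj₁ (j , _ , a<j , _ , 0≡j∸a)) → ⊥-elim (<-irrefl 0≡j∸a (m<n⇒0<n∸m a<j))
    ; (inj₂ (() , _)) }
  Des-before {suc i} i<d′ =
    ⇔.trans (Des-++ˡ xs ys (subst (suc (suc i) ≤_) (sym |xs|) i<d′)) (⇔.trans (Des-take d (drop a π) (suc i)) (mk⇔ to from))
    where
    to : Des (drop a π) (suc i) × suc (suc i) ≤ d → RHS (suc i)
    to (D , _) = inj₁ (a + suc i , subst (Des π) (sym (+-suc a i)) (Equivalence.to (Des-drop a π i) D) ,
                       m<m+n a (s≤s z≤n) , +-monoʳ-< a i<d′ , sym (m+n∸m≡n a (suc i)))
    from : RHS (suc i) → Des (drop a π) (suc i) × suc (suc i) ≤ d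
    from (inj₁ (j , D , a<j , _ , i≡j∸a)) = Equivalence.from (Des-drop a π i) (subst (Des π) j≡ D) , i<d′
      where
      j≡ : j ≡ suc (a + i)
      j≡ = trans (sym (m+[n∸m]≡n (<⇒≤ a<j))) (trans (cong (a +_) (sym i≡j∸a)) (+-suc a i))
    from (inj₂ (d≤i , _)) = ⊥-elim (<⇒≱ i<d′ d≤i)

  Des-at : Des (xs ++ ys) d ⇔ RHS d
  Des-at = ⇔.trans join (⇔.trans (mk⇔ to from) (⇔.sym (subst (RHS d ⇔_) (cong (_≤ length π) at-length) (RHS-tail ≤-refl))))
    where
    at-length : suc d′ + 1 + ρ + a ≡ suc (a + suc d′ + ρ)
    at-length = solve (a ∷ d′ ∷ ρ ∷ [])
    join : Des (xs ++ ys) d ⇔ (1 ≤ length ys × get ys 1 < get xs d)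
    join = subst (λ m → Des (xs ++ ys) m ⇔ (1 ≤ length ys × get ys 1 < get xs m)) |xs|
                 (Des-++-join xs ys (subst (1 ≤_) (sym |xs|) (s≤s z≤n)))
    |ys| = length-drop (b + ρ) π
    get-ys-1 : get ys 1 ≡ get π (suc (b + ρ))
    get-ys-1 = trans (get-drop (b + ρ) π 0) (cong (λ m → get π (suc m)) (+-identityʳ (b + ρ)))
    get-xs-d : get xs d ≡ get π b
    get-xs-d = trans (get-take d (drop a π) ≤-refl) (trans (get-drop a π d′) (cong (get π) (sym (+-suc a d′))))
    to : 1 ≤ length ys × get ys 1 < get xs d → suc (b + ρ) ≤ length π
    to (1≤ys , _) = Equivalence.to (≤∸⇔+≤ (s≤s z≤n)) (subst (1 ≤_) |ys| 1≤ys)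
    from : suc (b + ρ) ≤ length π → 1 ≤ length ys × get ys 1 < get xs d
    from room = subst (1 ≤_) (sym |ys|) (Equivalence.from (≤∸⇔+≤ (s≤s z≤n)) room) ,
      subst₂ _<_ (sym get-ys-1) (sym get-xs-d)
        (rl-tail ≤-refl (m+n≤o⇒m≤o b (<⇒≤ room)) (suc (b + ρ)) (s≤s (m≤m+n b ρ)) room)

  Des-after : ∀ j → Des (xs ++ ys) (suc (d + j)) ⇔ RHS (suc (d + j))
  Des-after j =
    ⇔.trans (subst (λ m → Des (xs ++ ys) (suc (m + j)) ⇔ Des ys (suc j)) |xs| (Des-++ʳ xs ys j))
      (⇔.trans (Des-drop (b + ρ) π j) (⇔.trans (mk⇔ (proj₁ ∘ proj₂) from)
        (⇔.sym (subst (RHS (suc (d + j)) ⇔_) (cong (_≤ length π) after-length) (RHS-tail (m≤n⇒m≤1+n (m≤m+n d j)))))))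
    where
    after-length : suc (suc d′ + j) + 1 + ρ + a ≡ suc (suc (a + suc d′ + ρ + j))
    after-length = solve (a ∷ d′ ∷ ρ ∷ j ∷ [])
    from : suc (suc (b + ρ + j)) ≤ length π → Des π (suc (b + ρ + j))
    from room = RLmax⇒Des π (rl-tail (≤-trans (m≤m+n b ρ) (≤-trans (m≤m+n (b + ρ) j) (n≤1+n _))) (<⇒≤ room)) (s≤s z≤n) room

  descents : ∀ i → Des (xs ++ ys) i ⇔ RHS i
  descents i with position d i
  ... | before i<d = Des-before i<d
  ... | at         = Des-at
  ... | after j    = Des-after j

Des-take-drop++drop : ∀ π {a b d ρ} → a + d ≡ b → 1 ≤ d → b + ρ ≤ length π →
  (∀ {j} → b ≤ j → j ≤ length π → RLmax π j) →
  ∀ i → Des (take d (drop a π) ++ drop (b + ρ) π) i ⇔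
        ((∃ λ j → Des π j × a < j × j < b × i ≡ j ∸ a) ⊎ (d ≤ i × i ≤ (length π ∸ a ∸ ρ) ∸ 1))
Des-take-drop++drop π refl (s≤s z≤n) = SegmentAndSuffix.descents π

allB-∈ : ∀ (p : ℕ → Bool) {xs x} → T (allB p xs) → x ∈ xs → T (p x)
allB-∈ p {y ∷ ys} t (here refl) = proj₁ (Equivalence.to T-∧ t)
allB-∈ p {y ∷ ys} t (there x∈) = allB-∈ p (proj₂ (Equivalence.to T-∧ t)) x∈

∈-interval : ∀ {x y k} → x ≤ k → k ≤ y → k ∈ interval x y
∈-interval {x} x≤k k≤y = subst (_∈ interval x _) (m+[n∸m]≡n x≤k) (∈-applyUpTo⁺ (x +_) (∸-monoˡ-< (s≤s k≤y) x≤k))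

∈-range1⁺ : ∀ {v n} → 1 ≤ v → v ≤ n → v ∈ range1 n
∈-range1⁺ (s≤s z≤n) v≤n = ∈-applyUpTo⁺ suc v≤n

∈-range1⁻ : ∀ {v n} → v ∈ range1 n → 1 ≤ v × v ≤ n
∈-range1⁻ v∈ with ∈-applyUpTo⁻ suc v∈
... | _ , i<n , refl = s≤s z≤n , i<n

isRLmax⇒RLmax : ∀ π i → isRLmax π i ≡ true → RLmax π i
isRLmax⇒RLmax π i eq k i<k k≤L =
  <ᵇ⇒< _ _ (allB-∈ (λ j → get π j <ᵇ get π i) (Equivalence.from T-≡ eq) (∈-interval i<k k≤L))

isRLmax-last : ∀ π → isRLmax π (length π) ≡ true
isRLmax-last π rewrite n∸n≡0 (length π) = refl

maxList-ub : ∀ {x} xs → x ∈ xs → x ≤ maxList xs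
maxList-ub (y ∷ ys) (here refl) = m≤m⊔n y (maxList ys)
maxList-ub (y ∷ ys) (there x∈)  = ≤-trans (maxList-ub ys x∈) (m≤n⊔m y (maxList ys))

maxList-∈ : ∀ xs → maxList xs ≡ 0 ⊎ maxList xs ∈ xs
maxList-∈ []       = inj₁ refl
maxList-∈ (y ∷ ys) with ⊔-sel y (maxList ys) | maxList-∈ ys
... | inj₁ eq | _         = inj₂ (here eq)
... | inj₂ eq | inj₁ eq₀  = inj₁ (trans eq eq₀)
... | inj₂ eq | inj₂ max∈ = inj₂ (there (subst (_∈ ys) (sym eq) max∈))

maxList-filter : ∀ {P : ℕ → Set} (P? : Decidable P) xs →
  maxList (filter P? xs) ≡ 0 ⊎ (maxList (filter P? xs) ∈ xs × P (maxList (filter P? xs)))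
maxList-filter P? xs with maxList-∈ (filter P? xs)
... | inj₁ eq   = inj₁ eq
... | inj₂ max∈ = inj₂ (∈-filter⁻ P? max∈)

RLmax-from-φb : ∀ π {j} → φb π ≤ j → j ≤ length π → RLmax π j
RLmax-from-φb π {j} b≤j j≤L with isRLmax π j in eq
... | true  = isRLmax⇒RLmax π j eq
... | false = ⊥-elim (<⇒≱ (s≤s (maxList-ub _ j∈)) b≤j)
  where
  j∈ = ∈-filter⁺ (λ i → not (isRLmax π i) Data.Bool.≟ true) (∈-range1⁺ (≤-trans (s≤s z≤n) b≤j) j≤L) (cong not eq)

φb≤length : ∀ π → 1 ≤ length π → φb π ≤ length π
φb≤length π 1≤L with maxList-filter (λ i → not (isRLmax π i) Data.Bool.≟ true) (range1 (length π))
... | inj₁ eq          = subst (λ m → suc m ≤ length π) (sym eq) 1≤L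
... | inj₂ (m∈ , notRL) = ≤∧≢⇒< (proj₂ (∈-range1⁻ m∈)) λ m≡L →
  not-true (trans (cong (isRLmax π) m≡L) (isRLmax-last π)) notRL
  where
  not-true : ∀ {x} → x ≡ true → not x ≢ true
  not-true refl ()

φa-spec : ∀ π → φa π ≡ 0 ⊎ (φa π < φb π × isRLmax π (φa π) ≡ true)
φa-spec π with maxList-filter (λ i → (isRLmax π i ∧ (i <ᵇ φb π)) Data.Bool.≟ true) (range1 (length π))
... | inj₁ eq      = inj₁ eq
... | inj₂ (_ , p) with Equivalence.to T-∧ (Equivalence.from T-≡ p)
...   | rl , a<b = inj₂ (<ᵇ⇒< _ _ a<b , Equivalence.to T-≡ rl)

φa<φb : ∀ π → φa π < φb π
φa<φb π with φa-spec π
... | inj₁ eq       = subst (_< φb π) (sym eq) (s≤s z≤n)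
... | inj₂ (a<b , _) = a<b

RLmax-φa : ∀ π → 1 ≤ φa π → RLmax π (φa π)
RLmax-φa π 1≤a with φa-spec π
... | inj₁ eq       = ⊥-elim (<-irrefl (sym eq) 1≤a)
... | inj₂ (_ , rl) = isRLmax⇒RLmax π (φa π) rl

ρ≤length∸φb : ∀ π → ρ π ≤ length π ∸ φb π
ρ≤length∸φb π = ≤-trans (length-filter (λ i → (isRLmax π i ∧ (χ π <ᵇ get π i)) Data.Bool.≟ true) (interval (suc (φb π)) (length π)))
                        (≤-reflexive (length-applyUpTo (suc (φb π) +_) (length π ∸ φb π)))

length-IsPerm : ∀ {n π} → IsPerm n π → length π ≡ n
length-IsPerm {n} π↭ = trans (↭-length π↭) (length-applyUpTo suc n)

nonempty : ∀ π → π ≢ decreasing (length π) → 1 ≤ length π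
nonempty []      π≢dec = ⊥-elim (π≢dec refl)
nonempty (_ ∷ _) _     = s≤s z≤n

lemma3 : (n : ℕ) (π : List ℕ) → IsPerm n π → Avoids1423 π → ¬ (π ≡ decreasing n) →
    (∀ i → Des (π⁽¹⁾ π) i ⇔
      ((Des π i × 1 ≤ i × i ≤ φa π) ⊎ (φa π + 1 ≤ i × i ≤ (φa π + ρ π + 1) ∸ 1)))
    ×
    (∀ i → Des (π⁽²⁾ π) i ⇔
      ((∃ λ j → Des π j × φa π < j × j < φb π × i ≡ j ∸ φa π)
        ⊎ (φb π ∸ φa π ≤ i × i ≤ (n ∸ φa π ∸ ρ π) ∸ 1)))
lemma3 n π π↭ _ π≢dec rewrite sym (length-IsPerm π↭) =
  via-std (take (φa π) π ++ take (suc (ρ π)) (drop (φb π ∸ 1) π))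
    (Des-take++take-drop π a<b b+ρ≤L (RLmax-φa π) (RLmax-from-φb π)) ,
  via-std (take (φb π ∸ φa π) (drop (φa π) π) ++ drop (φb π + ρ π) π)
    (Des-take-drop++drop π (m+[n∸m]≡n (<⇒≤ a<b)) (m<n⇒0<n∸m a<b) b+ρ≤L (RLmax-from-φb π))
  where
  via-std : ∀ xs {P : ℕ → Set} → (∀ i → Des xs i ⇔ P i) → ∀ i → Des (std xs) i ⇔ P i
  via-std xs Des-xs i = ⇔.trans (Des-std xs i) (Des-xs i)
  a<b = φa<φb π
  b≤L = φb≤length π (nonempty π π≢dec)
  b+ρ≤L : φb π + ρ π ≤ length π
  b+ρ≤L = ≤-trans (+-monoʳ-≤ (φb π) (ρ≤length∸φb π)) (≤-reflexive (m+[n∸m]≡n b≤L))
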